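{- $\mathsf{RCA}_0$ proves: for any finite set $\mathcal{S}$ of diagrams, $\mathrm{ucl}(\widehat{\mathcal{S}})=\overline{\mathcal{S}}\cup\mathrm{ucl}(\mathcal{S})$. Moreover $\mathrm{ucl}(\widehat{\mathcal{S}})$ is closed, includes $\mathcal{S}$, and is included in every closed set of diagrams that includes $\mathcal{S}$.
   Context: A diagram (Young diagram) is a partition $m_1\ge\cdots\ge m_k>0$ with $k>0$, viewed as left-justified rows of boxes; $|D|$ is the number of boxes. $r_i(D)$ is the length of the $i$th row (0 if none), $c_i(D)$ the length of the $i$th column. $D\le E$ means $r_i(D)\le r_i(E)$ for all $i$; $D<E$ means $D\le E$, $D\ne E$. $D\cup E$ is the diagram with rows $\max(r_i(D),r_i(E))$. $\mathrm{ucl}(\mathcal{T})=\{E:\exists D\in\mathcal{T},\ D\le E\}$. A set $\mathcal{U}$ of diagrams is closed if for every diagram $D$: $D\in\mathcal{U}\iff\forall E\,(E>D\Rightarrow E\in\mathcal{U})$. $(D)_r$ is the diagram with $r_1((D)_r)=\max(r_2(D),1)$ and $r_i((D)_r)=r_i(D)$ for $i>1$; $(D)_c$ is the diagram with $c_1((D)_c)=\max(c_2(D),1)$ and $c_i((D)_c)=c_i(D)$ for $i>1$. For finite $\mathcal{S}$: $\widehat{\mathcal{S}}=\{(D)_r\cup(E)_c: D,E\in\mathcal{S}\}$, $\|\mathcal{S}\|=\max\{(r_1(D)-1)(c_1(E)-1): D,E\in\mathcal{S}\}$, and $\overline{\mathcal{S}}=\{F\in\mathrm{ucl}(\widehat{\mathcal{S}}):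 |F|\le\|\mathcal{S}\|\}$. -}

module Defs where

open import Data.Nat using (ℕ; zero; suc; _+_; _*_; _∸_; _≤_; _<_; _⊔_; _≤?_)
open import Data.List using (List; []; _∷_; map; filter; length; foldr; concatMap; upTo)
open import Data.Nat.ListAction using (sum)
open import Data.List.Relation.Unary.All using (All)
open import Data.List.Relation.Unary.Linked using (Linked)
open import Data.List.Membership.Propositional using (_∈_)
open import Data.Product using (_×_; ∃; ∃-syntax; _,_)
open import Data.Sum using (_⊎_)
open import Relation.Binary.PropositionalEquality using (_≡_; _≢_)
open import Function.Bundles using (_⇔_)

-- A diagram is represented by its list of row lengths m₁ ≥ ⋯ ≥ mₖ > 0, k > 0.
IsDiagram : List ℕ → Set
IsDiagram D = (D ≢ []) × All (λ m → 0 < m) D × Linked (λ a b → b ≤ a) D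

DSet : Set₁
DSet = List ℕ → Set

-- r i D (1-based; 0 if there is no i-th row; r 0 D = 0 by convention)
r : ℕ → List ℕ → ℕ
r zero    D        = 0
r (suc i) []       = 0
r 1       (m ∷ D)  = m
r (suc (suc i)) (m ∷ D) = r (suc i) D

-- c i D : length of the i-th column = number of rows of length ≥ i (1-based)
c : ℕ → List ℕ → ℕ
c i D = length (filter (λ m → i ≤? m) D)

size : List ℕ → ℕ
size = sum

_⊑_ : List ℕ → List ℕ → Set
D ⊑ E = ∀ i → r i D ≤ r i E

_⊏_ : List ℕ → List ℕ → Set
D ⊏ E = D ⊑ E × D ≢ E

_∪_ : List ℕ → List ℕ → List ℕ
[]      ∪ E       = E
(m ∷ D) ∪ []      = m ∷ D
(m ∷ D) ∪ (n ∷ E) = (m ⊔ n) ∷ (D ∪ E)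

conj : List ℕ → List ℕ
conj D = map (λ j → c (suc j) D) (upTo (r 1 D))

rowOp : List ℕ → List ℕ
rowOp []      = []
rowOp (m ∷ D) = (r 1 D ⊔ 1) ∷ D

-- (D)_c : first column replaced by max(c₂(D),1), other columns unchanged
colOp : List ℕ → List ℕ
colOp D = conj (rowOp (conj D))

ucl : DSet → DSet
ucl T E = IsDiagram E × ∃[ D ] (T D × D ⊑ E)

Closed : DSet → Set
Closed U = ∀ D → IsDiagram D → (U D ⇔ (∀ E → IsDiagram E → D ⊏ E → U E))

toSet : List (List ℕ) → DSet
toSet S D = D ∈ S

hat : List (List ℕ) → DSet
hat S F = ∃[ D ] ∃[ E ] (D ∈ S × E ∈ S × F ≡ rowOp D ∪ colOp E)

-- ‖S‖ (maximum over pairs; 0 for empty S)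
norm : List (List ℕ) → ℕ
norm S = foldr _⊔_ 0 (concatMap (λ D → map (λ E → (r 1 D ∸ 1) * (c 1 E ∸ 1)) S) S)

bar : List (List ℕ) → DSet
bar S F = ucl (hat S) F × size F ≤ norm S

module Submission where

-- Write ĝ A B = (A)_r ∪ (B)_c, so Ŝ = { ĝ A B : A, B ∈ S }.  A box (i, k)
-- of D (0-based) is a pair with k < r (i+1) D.
--  * Duality: for weakly decreasing rows, row i has more than k boxes iff
--    column k has more than i boxes.  Hence conjugation transposes boxes,
--    and the boxes of (B)_c outside the first column are those of B.  This
--    characterises (A)_r ⊑ F (rows 2, 3, … of A fit in F) and (B)_c ⊑ F
--    (the boxes of B outside the first column lie in F).
--  * Trichotomy: if ĝ A B ⊑ F then A ⊑ F, or B ⊑ F, or F fits in the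
--    (r₁(A)−1) × (c₁(B)−1) rectangle, so |F| ≤ ‖S‖.  This gives the
--    equation ucl(Ŝ) = S̄ ∪ ucl(S).
--  * Closedness: if the two extensions of D ("first row + 1" and "extra
--    row of length 1") lie above ĝ A₁ B₁ and ĝ A₂ B₂, then ĝ A₁ B₂ ⊑ D.
--  * Minimality: a closed set containing every diagram above G of size
--    larger than N contains every diagram above G (induction on size);
--    by the trichotomy this applies to every closed set containing S.

open import Defs
open import Data.Nat using (ℕ; zero; suc; _+_; _*_; _∸_; _≤_; _<_; _⊔_; _≤?_; _<?_; _≟_; z≤n; s≤s)
open import Data.Nat.Properties
open import Data.List using (List; []; _∷_; map; length; foldr; applyUpTo; drop; _++_)
open import Data.List.Properties using (filter-accept; filter-reject; map-applyUpTo; ≡-dec; ∷-injectiveʳ)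
open import Data.List.Relation.Unary.All using (All; []; _∷_; lookup)
open import Data.List.Relation.Unary.All.Properties using (++⁺)
open import Data.List.Relation.Unary.Any using (here; there)
import Data.List.Relation.Unary.Any as Any
open import Data.List.Relation.Unary.Linked using (Linked; []; [-]; _∷_)
open import Data.List.Relation.Binary.Sublist.Propositional using (⊆-refl)
open import Data.List.Relation.Binary.Sublist.Propositional.Properties using (filter⁺; length-mono-≤)
open import Data.List.Membership.Propositional using (_∈_)
open import Data.List.Membership.Propositional.Properties using (∈-map⁺; ∈-concatMap⁺)
open import Data.Product using (_×_; _,_; proj₁; proj₂)
open import Data.Sum using (_⊎_; inj₁; inj₂)
open import Data.Empty using (⊥-elim)
open import Function.Base using (id)
open import Function.Bundles using (_⇔_; Equivalence; mk⇔)
open import Relation.Nullary using (¬_; yes; no)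
open import Relation.Binary.PropositionalEquality using (_≡_; _≢_; refl; sym; trans; cong; subst; subst₂)

-- Weakly decreasing rows, phrased through r so that it applies equally to
-- conjugates, which are built by a different recursion than cons-lists.
-- (A record, so that the list is recoverable from a proof by unification.)
record Descending (Y : List ℕ) : Set where
  constructor rows-decrease
  field decreases : ∀ i → r (suc (suc i)) Y ≤ r (suc i) Y
open Descending

descending-tail : ∀ {y Y} → Descending (y ∷ Y) → Descending Y
descending-tail d = rows-decrease (λ i → decreases d (suc i))

linked⇒descending : ∀ {Y} → Linked (λ a b → b ≤ a) Y → Descending Y
linked⇒descending l = rows-decrease (step l)
  where
    step : ∀ {Y} → Linked (λ a b → b ≤ a) Y → ∀ i → r (suc (suc i)) Y ≤ r (suc i) Y
    step []      i       = z≤n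
    step [-]     i       = z≤n
    step (p ∷ l) zero    = p
    step (p ∷ l) (suc i) = step l i

row≤first : ∀ {Y} → Descending Y → ∀ i → r (suc i) Y ≤ r 1 Y
row≤first d zero    = ≤-refl
row≤first d (suc i) = ≤-trans (decreases d i) (row≤first d i)

descending : ∀ {D} → IsDiagram D → Descending D
descending (_ , _ , l) = linked⇒descending l

positive : ∀ {D} → IsDiagram D → All (0 <_) D
positive (_ , ps , _) = ps

first-row-pos : ∀ {D} → IsDiagram D → 0 < r 1 D
first-row-pos {[]}    (D≢[] , _)   = ⊥-elim (D≢[] refl)
first-row-pos {d ∷ D} (_ , p ∷ _ , _) = p

c-cons-≤ : ∀ {k y} Y → k ≤ y → c k (y ∷ Y) ≡ suc (c k Y)
c-cons-≤ {k} Y k≤y = cong length (filter-accept (k ≤?_) k≤y)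

c-cons-≰ : ∀ {k y} Y → ¬ k ≤ y → c k (y ∷ Y) ≡ c k Y
c-cons-≰ {k} Y k≰y = cong length (filter-reject (k ≤?_) k≰y)

-- The rows of length ≥ k form a sublist of the rows of length ≥ j ≤ k.
c-antitone : ∀ {j k} Y → j ≤ k → c k Y ≤ c j Y
c-antitone {j} {k} Y j≤k =
  length-mono-≤ (filter⁺ (k ≤?_) (j ≤?_) (λ { refl k≤y → ≤-trans j≤k k≤y }) (⊆-refl {x = Y}))

row⇒column : ∀ {Y} → Descending Y → ∀ i k → k < r (suc i) Y → i < c (suc k) Y
row⇒column {[]}    d i k ()
row⇒column {y ∷ Y} d i k k<row with suc k ≤? y
... | no k≮y = ⊥-elim (k≮y (≤-trans k<row (row≤first d i)))
row⇒column {y ∷ Y} d zero    k _     | yes k<y rewrite c-cons-≤ Y k<y = s≤s z≤n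
row⇒column {y ∷ Y} d (suc i) k k<row | yes k<y rewrite c-cons-≤ Y k<y =
  s≤s (row⇒column (descending-tail d) i k k<row)

column⇒row : ∀ {Y} → Descending Y → ∀ i k → i < c (suc k) Y → k < r (suc i) Y
column⇒row {[]}    d i k ()
column⇒row {y ∷ Y} d i k i<col with suc k ≤? y
column⇒row {y ∷ Y} d zero    k _     | yes k<y = k<y
column⇒row {y ∷ Y} d (suc i) k i<col | yes k<y rewrite c-cons-≤ Y k<y =
  column⇒row (descending-tail d) i k (≤-pred i<col)
-- if y ≤ k then no row of Y, in particular not its first row, exceeds k
column⇒row {y ∷ Y} d i k i<col | no k≮y rewrite c-cons-≰ Y k≮y =
  ⊥-elim (k≮y (≤-trans (column⇒row (descending-tail d) 0 k (≤-trans (s≤s z≤n) i<col)) (decreases d 0)))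

r-applyUpTo : ∀ (g : ℕ → ℕ) n i → i < n → r (suc i) (applyUpTo g n) ≡ g i
r-applyUpTo g (suc n) zero    _         = refl
r-applyUpTo g (suc n) (suc i) (s≤s i<n) = r-applyUpTo (λ j → g (suc j)) n i i<n

r-applyUpTo-beyond : ∀ (g : ℕ → ℕ) n i → n ≤ i → r (suc i) (applyUpTo g n) ≡ 0
r-applyUpTo-beyond g zero    i       _         = refl
r-applyUpTo-beyond g (suc n) (suc i) (s≤s n≤i) = r-applyUpTo-beyond (λ j → g (suc j)) n i n≤i

conj-row : ∀ {Y} → Descending Y → ∀ i → r (suc i) (conj Y) ≡ c (suc i) Y
conj-row {Y} d i rewrite map-applyUpTo id (λ j → c (suc j) Y) (r 1 Y) with i <? r 1 Y
... | yes i<r₁ = r-applyUpTo _ _ i i<r₁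
... | no  i≮r₁ = trans (r-applyUpTo-beyond _ _ i (≮⇒≥ i≮r₁)) (sym empty-column)
  where
    empty-column : c (suc i) Y ≡ 0
    empty-column = n≤0⇒n≡0 (≮⇒≥ (λ 0<col → i≮r₁ (column⇒row d 0 i 0<col)))

conj-descending : ∀ {Y} → Descending Y → Descending (conj Y)
conj-descending {Y} d = rows-decrease λ i →
  subst₂ _≤_ (sym (conj-row d (suc i))) (sym (conj-row d i)) (c-antitone Y (n≤1+n (suc i)))

conj-box⇒ : ∀ {Y} → Descending Y → ∀ i k → k < r (suc i) (conj Y) → i < r (suc k) Y
conj-box⇒ d i k k<row = column⇒row d k i (subst (k <_) (conj-row d i) k<row)

conj-box⇐ : ∀ {Y} → Descending Y → ∀ i k → i < r (suc k) Y → k < r (suc i) (conj Y)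
conj-box⇐ d i k i<row = subst (k <_) (sym (conj-row d i)) (row⇒column d k i i<row)

rowOp-tail : ∀ X i → r (suc (suc i)) (rowOp X) ≡ r (suc (suc i)) X
rowOp-tail []      i = refl
rowOp-tail (x ∷ X) i = refl

rowOp-first : ∀ X → r 1 (rowOp X) ≤ r 2 X ⊔ 1
rowOp-first []      = z≤n
rowOp-first (x ∷ X) = ≤-refl

rowOp-descending : ∀ {X} → Descending X → Descending (rowOp X)
rowOp-descending {[]}    d = rows-decrease λ _ → z≤n
rowOp-descending {x ∷ X} d = rows-decrease λ where
  zero    → m≤m⊔n _ 1
  (suc i) → decreases d (suc i)

colOp-box⇒ : ∀ {E} → Descending E → ∀ i k → suc k < r (suc i) (colOp E) → suc k < r (suc i) E
colOp-box⇒ {E} d i k box =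
  conj-box⇒ d (suc k) i
    (subst (i <_) (rowOp-tail (conj E) k)
      (conj-box⇒ (rowOp-descending (conj-descending d)) i (suc k) box))

colOp-box⇐ : ∀ {E} → Descending E → ∀ i k → suc k < r (suc i) E → suc k < r (suc i) (colOp E)
colOp-box⇐ {E} d i k box =
  conj-box⇐ (rowOp-descending (conj-descending d)) i (suc k)
    (subst (i <_) (sym (rowOp-tail (conj E) k)) (conj-box⇐ d (suc k) i box))

≤⊔1⇒≤ : ∀ {a b} → 2 ≤ a → a ≤ b ⊔ 1 → a ≤ b
≤⊔1⇒≤ {b = zero}  2≤a a≤1 = ⊥-elim (<⇒≱ 2≤a a≤1)
≤⊔1⇒≤ {a} {suc b} _   a≤  = subst (a ≤_) (cong suc (⊔-identityʳ b)) a≤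

-- Below the first row, the first column of (E)_c is within the second
-- column of E: its length is max(c₂(E), 1).
colOp-first-column : ∀ {E} → Descending E → ∀ i → 0 < r (suc (suc i)) (colOp E) → 1 < r (suc (suc i)) E
colOp-first-column {E} d i box = column⇒row d (suc i) 1 (≤⊔1⇒≤ (s≤s (s≤s z≤n)) in-rowOp)
  where
    in-rowOp : suc i < c 2 E ⊔ 1
    in-rowOp = ≤-trans (conj-box⇒ (rowOp-descending (conj-descending d)) (suc i) 0 box)
                 (≤-trans (rowOp-first (conj E)) (≤-reflexive (cong (_⊔ 1) (conj-row d 1))))

≤-from-boxes : ∀ {a b} → (∀ k → k < a → k < b) → a ≤ b
≤-from-boxes {zero}  _ = z≤n
≤-from-boxes {suc a} h = h a ≤-refl

⊑-trans : ∀ {X Y Z} → X ⊑ Y → Y ⊑ Z → X ⊑ Z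
⊑-trans X⊑Y Y⊑Z i = ≤-trans (X⊑Y i) (Y⊑Z i)

-- Rows 2, 3, … of D fit in F (the condition for (D)_r ⊑ F).
_⊑ʳ_ : List ℕ → List ℕ → Set
D ⊑ʳ F = ∀ i → r (suc (suc i)) D ≤ r (suc (suc i)) F

-- Every box of D outside the first column is a box of F (the condition
-- for (D)_c ⊑ F).
_⊑ᶜ_ : List ℕ → List ℕ → Set
D ⊑ᶜ F = ∀ i k → suc k < r (suc i) D → suc k < r (suc i) F

rowOp-⊑ : ∀ {A F} → Descending F → 0 < r 1 F → A ⊑ʳ F → rowOp A ⊑ F
rowOp-⊑     dF f₁ h zero          = z≤n
rowOp-⊑ {A} dF f₁ h (suc zero)    = ≤-trans (rowOp-first A) (⊔-lub (≤-trans (h 0) (decreases dF 0)) f₁)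
rowOp-⊑ {A} dF f₁ h (suc (suc i)) = subst (_≤ _) (sym (rowOp-tail A i)) (h i)

rowOp-⊑⁻ : ∀ {A F} → rowOp A ⊑ F → A ⊑ʳ F
rowOp-⊑⁻ {A} h i = subst (_≤ _) (rowOp-tail A i) (h (suc (suc i)))

-- (E)_c ⊑ F iff the boxes of E outside the first column lie in F: the
-- first column of (E)_c has length max(c₂(E), 1), which F accommodates.
colOp-⊑ : ∀ {E F} → Descending E → IsDiagram F → E ⊑ᶜ F → colOp E ⊑ F
colOp-⊑         dE dF h zero    = z≤n
colOp-⊑ {E} {F} dE dF h (suc i) = ≤-from-boxes (box i)
  where
    box : ∀ i k → k < r (suc i) (colOp E) → k < r (suc i) F
    box i       (suc k) b = h i k (colOp-box⇒ dE i k b)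
    box zero    zero    _ = first-row-pos dF
    box (suc i) zero    b = <⇒≤ (h (suc i) 0 (colOp-first-column dE i b))

colOp-⊑⁻ : ∀ {E F} → Descending E → colOp E ⊑ F → E ⊑ᶜ F
colOp-⊑⁻ dE h i k b = ≤-trans (colOp-box⇐ dE i k b) (h (suc i))

⊑-from-first-row : ∀ {A F} → r 1 A ≤ r 1 F → A ⊑ʳ F → A ⊑ F
⊑-from-first-row p h zero          = z≤n
⊑-from-first-row p h (suc zero)    = p
⊑-from-first-row p h (suc (suc i)) = h i

⊑-from-first-column : ∀ {B F} → Descending B → Descending F → c 1 B ≤ c 1 F → B ⊑ᶜ F → B ⊑ F
⊑-from-first-column         dB dF p h zero    = z≤n
⊑-from-first-column {B} {F} dB dF p h (suc i) = ≤-from-boxes box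
  where
    box : ∀ k → k < r (suc i) B → k < r (suc i) F
    box zero    b = column⇒row dF i 0 (≤-trans (row⇒column dB i 0 b) p)
    box (suc k) b = h i k b

∪-row : ∀ X Y i → r i (X ∪ Y) ≡ r i X ⊔ r i Y
∪-row X       Y       zero          = refl
∪-row []      Y       (suc i)       = refl
∪-row (x ∷ X) []      (suc i)       = sym (⊔-identityʳ _)
∪-row (x ∷ X) (y ∷ Y) (suc zero)    = refl
∪-row (x ∷ X) (y ∷ Y) (suc (suc i)) = ∪-row X Y (suc i)

∪-least : ∀ {X Y F} → X ⊑ F → Y ⊑ F → (X ∪ Y) ⊑ F
∪-least {X} {Y} X⊑F Y⊑F i rewrite ∪-row X Y i = ⊔-lub (X⊑F i) (Y⊑F i)

∪-⊑-split : ∀ {X Y F} → (X ∪ Y) ⊑ F → X ⊑ F × Y ⊑ F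
∪-⊑-split {X} {Y} h =
  (λ i → ≤-trans (m≤m⊔n _ _) (subst (_≤ _) (∪-row X Y i) (h i))) ,
  (λ i → ≤-trans (m≤n⊔m _ _) (subst (_≤ _) (∪-row X Y i) (h i)))

ĝ : List ℕ → List ℕ → List ℕ
ĝ A B = rowOp A ∪ colOp B

ĝ-self : ∀ {A} → IsDiagram A → ĝ A A ⊑ A
ĝ-self dA = ∪-least (rowOp-⊑ (descending dA) (first-row-pos dA) (λ _ → ≤-refl))
                    (colOp-⊑ (descending dA) dA (λ _ _ b → b))

size-bound : ∀ {F} → All (0 <_) F → Descending F → size F ≤ r 1 F * c 1 F
size-bound {[]}    []       d = z≤n
size-bound {f ∷ F} (p ∷ ps) d rewrite c-cons-≤ F p | *-suc f (c 1 F) =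
  +-monoʳ-≤ f (≤-trans (size-bound ps (descending-tail d)) (*-monoˡ-≤ (c 1 F) (decreases d 0)))

⊑-tail : ∀ {x X Y} → (x ∷ X) ⊑ Y → X ⊑ drop 1 Y
⊑-tail {Y = []}    h zero    = z≤n
⊑-tail {Y = []}    h (suc i) = h (suc (suc i))
⊑-tail {Y = y ∷ Y} h zero    = z≤n
⊑-tail {Y = y ∷ Y} h (suc i) = h (suc (suc i))

size-mono : ∀ {X Y} → X ⊑ Y → size X ≤ size Y
size-mono {[]}            h = z≤n
size-mono {x ∷ X} {[]}    h = +-mono-≤ (h 1) (size-mono (⊑-tail h))
size-mono {x ∷ X} {y ∷ Y} h = +-mono-≤ (h 1) (size-mono (⊑-tail h))

size-strict : ∀ {X Y} → All (0 <_) X → All (0 <_) Y → X ⊑ Y → X ≢ Y → size X < size Y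
size-strict {[]}    {[]}    _       _        _ X≢Y = ⊥-elim (X≢Y refl)
size-strict {[]}    {y ∷ Y} _       (q ∷ _)  _ _   = ≤-trans q (m≤m+n y _)
size-strict {x ∷ X} {[]}    (p ∷ _) _        h _   = ⊥-elim (<⇒≱ p (h 1))
size-strict {x ∷ X} {y ∷ Y} (_ ∷ pX) (_ ∷ pY) h X≢Y with m≤n⇒m<n∨m≡n (h 1)
... | inj₁ x<y  = +-mono-<-≤ x<y (size-mono (⊑-tail h))
... | inj₂ refl = +-monoʳ-< x (size-strict pX pY (⊑-tail h) (λ X≡Y → X≢Y (cong (x ∷_) X≡Y)))

foldr-⊔-upper : ∀ {x} xs → x ∈ xs → x ≤ foldr _⊔_ 0 xs
foldr-⊔-upper (y ∷ ys) (here refl) = m≤m⊔n _ _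
foldr-⊔-upper (y ∷ ys) (there x∈)  = ≤-trans (foldr-⊔-upper ys x∈) (m≤n⊔m _ _)

norm-upper : ∀ {S A B} → A ∈ S → B ∈ S → (r 1 A ∸ 1) * (c 1 B ∸ 1) ≤ norm S
norm-upper {S} {A} {B} A∈S B∈S =
  foldr-⊔-upper _ (∈-concatMap⁺ (λ D → map (λ E → (r 1 D ∸ 1) * (c 1 E ∸ 1)) S)
    (Any.map (λ { refl → ∈-map⁺ (λ E → (r 1 A ∸ 1) * (c 1 E ∸ 1)) B∈S }) A∈S))

ĝ-trichotomy : ∀ {A B F} → Descending B → IsDiagram F → ĝ A B ⊑ F →
               A ⊑ F ⊎ B ⊑ F ⊎ size F ≤ (r 1 A ∸ 1) * (c 1 B ∸ 1)
ĝ-trichotomy {A} {B} {F} dB dF h with r 1 A ≤? r 1 F | c 1 B ≤? c 1 F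
... | yes p | _     = inj₁ (⊑-from-first-row p (rowOp-⊑⁻ (proj₁ (∪-⊑-split {rowOp A} h))))
... | no _  | yes q = inj₂ (inj₁ (⊑-from-first-column dB (descending dF) q
                                   (colOp-⊑⁻ dB (proj₂ (∪-⊑-split {rowOp A} h)))))
... | no p  | no q  = inj₂ (inj₂ (≤-trans (size-bound (positive dF) (descending dF))
                                   (*-mono-≤ (<⇒≤pred (≰⇒> p)) (<⇒≤pred (≰⇒> q)))))

-- The two minimal proper extensions of a diagram used for closedness:
-- enlarge the first row, or add a new row of length 1.
widen : List ℕ → List ℕ
widen []      = 1 ∷ []
widen (d ∷ D) = suc d ∷ D

widen-diagram : ∀ {D} → IsDiagram D → IsDiagram (widen D)
widen-diagram {[]}    (D≢[] , _)          = ⊥-elim (D≢[] refl)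
widen-diagram {d ∷ D} (_ , _ ∷ ps , desc) = (λ ()) , s≤s z≤n ∷ ps , grow desc
  where
    grow : Linked (λ a b → b ≤ a) (d ∷ D) → Linked (λ a b → b ≤ a) (suc d ∷ D)
    grow [-]          = [-]
    grow (e≤d ∷ desc) = m≤n⇒m≤1+n e≤d ∷ desc

widen-⊏ : ∀ D → D ⊏ widen D
widen-⊏ []      = (λ { zero → z≤n ; (suc i) → z≤n }) , (λ ())
widen-⊏ (d ∷ D) = grows , (λ e → <⇒≢ (n<1+n d) (cong (r 1) e))
  where
    grows : (d ∷ D) ⊑ (suc d ∷ D)
    grows zero          = z≤n
    grows (suc zero)    = n≤1+n d
    grows (suc (suc i)) = ≤-refl

⊑ʳ-widen : ∀ {A} D → A ⊑ʳ widen D → A ⊑ʳ D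
⊑ʳ-widen []      h = h
⊑ʳ-widen (d ∷ D) h = h

addRow : List ℕ → List ℕ
addRow D = D ++ 1 ∷ []

addRow-diagram : ∀ {D} → IsDiagram D → IsDiagram (addRow D)
addRow-diagram {D} (_ , ps , desc) = nonempty D , ++⁺ ps (s≤s z≤n ∷ []) , linked ps desc
  where
    nonempty : ∀ D → addRow D ≢ []
    nonempty []      ()
    nonempty (d ∷ D) ()
    linked : ∀ {D} → All (0 <_) D → Linked (λ a b → b ≤ a) D → Linked (λ a b → b ≤ a) (addRow D)
    linked []                _          = [-]
    linked (p ∷ [])          [-]        = p ∷ [-]
    linked (_ ∷ ps@(_ ∷ _))  (q ∷ desc) = q ∷ linked ps desc

addRow-⊏ : ∀ D → D ⊏ addRow D
addRow-⊏ D = grows D , differs D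
  where
    grows : ∀ D → D ⊑ addRow D
    grows D       zero          = z≤n
    grows []      (suc i)       = z≤n
    grows (d ∷ D) (suc zero)    = ≤-refl
    grows (d ∷ D) (suc (suc i)) = grows D (suc i)
    differs : ∀ D → D ≢ addRow D
    differs []      ()
    differs (d ∷ D) e = differs D (∷-injectiveʳ e)

-- The new row has length 1, so it carries no box outside the first column.
⊑ᶜ-addRow : ∀ {B} D → B ⊑ᶜ addRow D → B ⊑ᶜ D
⊑ᶜ-addRow {B} D h i k b = ≤⊔1⇒≤ (s≤s (s≤s z≤n)) (≤-trans (h i k b) (addRow-row D i))
  where
    addRow-row : ∀ D i → r (suc i) (addRow D) ≤ r (suc i) D ⊔ 1
    addRow-row []      zero    = ≤-refl
    addRow-row []      (suc i) = z≤n
    addRow-row (d ∷ D) zero    = m≤m⊔n d 1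
    addRow-row (d ∷ D) (suc i) = addRow-row D i

ĝ-merge : ∀ A₁ B₁ A₂ B₂ {D} → Descending B₂ → IsDiagram D →
          ĝ A₁ B₁ ⊑ widen D → ĝ A₂ B₂ ⊑ addRow D → ĝ A₁ B₂ ⊑ D
ĝ-merge A₁ B₁ A₂ B₂ {D} dB₂ dD h₁ h₂ = ∪-least
  (rowOp-⊑ {A₁} (descending dD) (first-row-pos dD)
    (⊑ʳ-widen {A₁} D (rowOp-⊑⁻ {A₁} (proj₁ (∪-⊑-split {rowOp A₁} {colOp B₁} h₁)))))
  (colOp-⊑ dB₂ dD (⊑ᶜ-addRow {B₂} D (colOp-⊑⁻ dB₂ (proj₂ (∪-⊑-split {rowOp A₂} {colOp B₂} h₂)))))

ucl-upward : ∀ {T X Y} → ucl T X → IsDiagram Y → X ⊑ Y → ucl T Y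
ucl-upward (_ , G , G∈T , G⊑X) dY X⊑Y = dY , G , G∈T , ⊑-trans G⊑X X⊑Y

closed⇒upward : ∀ {U X Y} → Closed U → IsDiagram X → IsDiagram Y → X ⊑ Y → U X → U Y
closed⇒upward {X = X} {Y} cU dX dY X⊑Y uX with ≡-dec _≟_ X Y
... | yes refl = uX
... | no  X≢Y  = Equivalence.to (cU X dX) uX Y dY (X⊑Y , X≢Y)

-- A closed set containing every diagram above G with more than N boxes
-- contains every diagram above G: induct on N + 1 − |F|, using that proper
-- extensions have more boxes.
closed-above : ∀ {U} → Closed U → ∀ G N →
               (∀ E → IsDiagram E → G ⊑ E → N < size E → U E) →
               ∀ F → IsDiagram F → G ⊑ F → U F
closed-above {U} cU G N large F dF G⊑F = go (suc N) F dF G⊑F (s≤s (m≤m+n N (size F)))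
  where
    go : ∀ k F → IsDiagram F → G ⊑ F → N < k + size F → U F
    go zero    F dF G⊑F N< = large F dF G⊑F N<
    go (suc k) F dF G⊑F N< = Equivalence.from (cU F dF) λ E dE (F⊑E , F≢E) →
      go k E dE (⊑-trans G⊑F F⊑E)
        (≤-<-trans (≤-pred N<) (+-monoʳ-< k (size-strict (positive dF) (positive dE) F⊑E F≢E)))

ucl-hat-⊇ : ∀ {S} → All IsDiagram S → ∀ D → D ∈ S → ucl (hat S) D
ucl-hat-⊇ diagS D D∈S = dD , ĝ D D , (D , D , D∈S , D∈S , refl) , ĝ-self dD
  where
    dD : IsDiagram D
    dD = lookup diagS D∈S

ucl-hat-decomposition : ∀ {S} → All IsDiagram S → ∀ F → IsDiagram F →
                        ucl (hat S) F ⇔ (bar S F ⊎ ucl (toSet S) F)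
ucl-hat-decomposition {S} diagS F dF = mk⇔ split join
  where
    split : ucl (hat S) F → bar S F ⊎ ucl (toSet S) F
    split h@(_ , _ , (A , B , A∈S , B∈S , refl) , G⊑F)
      with ĝ-trichotomy (descending (lookup diagS B∈S)) dF G⊑F
    ... | inj₁ A⊑F         = inj₂ (dF , A , A∈S , A⊑F)
    ... | inj₂ (inj₁ B⊑F)  = inj₂ (dF , B , B∈S , B⊑F)
    ... | inj₂ (inj₂ |F|≤) = inj₁ (h , ≤-trans |F|≤ (norm-upper A∈S B∈S))
    join : bar S F ⊎ ucl (toSet S) F → ucl (hat S) F
    join (inj₁ (h , _))             = h
    join (inj₂ (_ , A , A∈S , A⊑F)) = ucl-upward (ucl-hat-⊇ diagS A A∈S) dF A⊑F

-- ucl(Ŝ) is closed: D is recovered from its two extensions widen D, addRow D.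
ucl-hat-closed : ∀ {S} → All IsDiagram S → Closed (ucl (hat S))
ucl-hat-closed {S} diagS D dD = mk⇔ (λ h E dE (D⊑E , _) → ucl-upward h dE D⊑E) from-extensions
  where
    from-extensions : (∀ E → IsDiagram E → D ⊏ E → ucl (hat S) E) → ucl (hat S) D
    from-extensions above
      with above (widen D) (widen-diagram dD) (widen-⊏ D) | above (addRow D) (addRow-diagram dD) (addRow-⊏ D)
    ... | _ , _ , (A₁ , B₁ , A₁∈S , _ , refl) , h₁ | _ , _ , (A₂ , B₂ , _ , B₂∈S , refl) , h₂ =
      dD , ĝ A₁ B₂ , (A₁ , B₂ , A₁∈S , B₂∈S , refl) ,
      ĝ-merge A₁ B₁ A₂ B₂ (descending (lookup diagS B₂∈S)) dD h₁ h₂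

ucl-hat-least : ∀ {S} → All IsDiagram S → ∀ (U : DSet) → Closed U → (∀ D → D ∈ S → U D) →
                ∀ F → ucl (hat S) F → U F
ucl-hat-least diagS U cU S⊆U F (dF , _ , (A , B , A∈S , B∈S , refl) , G⊑F) =
  closed-above cU (ĝ A B) ((r 1 A ∸ 1) * (c 1 B ∸ 1)) large F dF G⊑F
  where
    dA : IsDiagram A
    dA = lookup diagS A∈S
    dB : IsDiagram B
    dB = lookup diagS B∈S
    large : ∀ E → IsDiagram E → ĝ A B ⊑ E → (r 1 A ∸ 1) * (c 1 B ∸ 1) < size E → U E
    large E dE G⊑E N<|E| with ĝ-trichotomy (descending dB) dE G⊑E
    ... | inj₁ A⊑E         = closed⇒upward cU dA dE A⊑E (S⊆U A A∈S)
    ... | inj₂ (inj₁ B⊑E)  = closed⇒upward cU dB dE B⊑E (S⊆U B B∈S)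
    ... | inj₂ (inj₂ |E|≤) = ⊥-elim (<⇒≱ N<|E| |E|≤)

theorem3p8 : (S : List (List ℕ)) → All IsDiagram S →
    (∀ F → IsDiagram F → (ucl (hat S) F ⇔ (bar S F ⊎ ucl (toSet S) F)))
    × Closed (ucl (hat S))
    × (∀ D → D ∈ S → ucl (hat S) D)
    × (∀ (U : DSet) → Closed U → (∀ D → D ∈ S → U D) → ∀ F → ucl (hat S) F → U F)
theorem3p8 S diagS =
  ucl-hat-decomposition diagS ,
  ucl-hat-closed diagS ,
  ucl-hat-⊇ diagS ,
  ucl-hat-least diagS
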